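{- The following identities hold in $\mathbb{Z}$: \begin{align*} 569936821221962380720^3+(-569936821113563493509)^3+(-472715493453327032)^3&=3,\\ (-80538738812075974)^3+80435758145817515^3+12602123297335631^3&=42,\\ (-385495523231271884)^3+383344975542639445^3+98422560467622814^3&=165,\\ 143075750505019222645^3+(-143070303858622169975)^3+(-6941531883806363291)^3&=579,\\ (-74924259395610397)^3+72054089679353378^3+35961979615356503^3&=906. \end{align*} In particular, the equation $x^3+y^3+z^3=3$ has an integer solution $(x,y,z)$ that is not a permutation of $(1,1,1)$ or $(4,4,-5)$. -}

module Defs where

open import Data.Integer using (ℤ; _+_; _*_)
open import Data.Product using (_×_)
open import Data.Sum using (_⊎_)
open import Relation.Binary.PropositionalEquality using (_≡_)

cube : ℤ → ℤ
cube x = x * x * x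

sum3cubes : ℤ → ℤ → ℤ → ℤ
sum3cubes x y z = cube x + cube y + cube z

IsPermOf : ℤ → ℤ → ℤ → ℤ → ℤ → ℤ → Set
IsPermOf x y z a b c =
  ((x ≡ a) × (y ≡ b) × (z ≡ c)) ⊎
  ((x ≡ a) × (y ≡ c) × (z ≡ b)) ⊎
  ((x ≡ b) × (y ≡ a) × (z ≡ c)) ⊎
  ((x ≡ b) × (y ≡ c) × (z ≡ a)) ⊎
  ((x ≡ c) × (y ≡ a) × (z ≡ b)) ⊎
  ((x ≡ c) × (y ≡ b) × (z ≡ a))

module Submission where

-- The five identities are closed integer computations: Agda's builtin
-- arbitrary-precision arithmetic normalises both sides, so each holds by
-- 'refl'.  For the final claim we take the new representation of 3 from
-- the first identity.  That it is not a permutation of (1,1,1) or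
-- (4,4,-5) follows from a general observation: in any permutation of
-- (a,b,c) the first coordinate is one of a, b, c, and the first
-- coordinate 569936821221962380720 is none of 1, 4, -5.

open import Defs
open import Data.Integer using (ℤ; +_; -_)
open import Data.Product using (_×_; ∃-syntax; _,_)
open import Data.Sum using (_⊎_; inj₁; inj₂)
open import Relation.Nullary using (¬_)
open import Relation.Binary.PropositionalEquality using (_≡_; refl)

permFirst : ∀ {x y z a b c : ℤ} → IsPermOf x y z a b c → x ≡ a ⊎ x ≡ b ⊎ x ≡ c
permFirst (inj₁ (x≡a , _))                                  = inj₁ x≡a
permFirst (inj₂ (inj₁ (x≡a , _)))                           = inj₁ x≡a
permFirst (inj₂ (inj₂ (inj₁ (x≡b , _))))                    = inj₂ (inj₁ x≡b)
permFirst (inj₂ (inj₂ (inj₂ (inj₁ (x≡b , _)))))             = inj₂ (inj₁ x≡b)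
permFirst (inj₂ (inj₂ (inj₂ (inj₂ (inj₁ (x≡c , _))))))      = inj₂ (inj₂ x≡c)
permFirst (inj₂ (inj₂ (inj₂ (inj₂ (inj₂ (x≡c , _))))))      = inj₂ (inj₂ x≡c)

notPermOf : ∀ {x y z a b c : ℤ} → ¬ x ≡ a → ¬ x ≡ b → ¬ x ≡ c →
            ¬ IsPermOf x y z a b c
notPermOf x≢a x≢b x≢c p with permFirst p
... | inj₁ x≡a        = x≢a x≡a
... | inj₂ (inj₁ x≡b) = x≢b x≡b
... | inj₂ (inj₂ x≡c) = x≢c x≡c

-- The first coordinate of the new solution for 3, and its distinctness
-- from the coordinates of the known solutions (decided by constructor
-- mismatch on the normalised literals).
x₃ : ℤ
x₃ = + 569936821221962380720

x₃≢1 : ¬ x₃ ≡ + 1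
x₃≢1 ()

x₃≢4 : ¬ x₃ ≡ + 4
x₃≢4 ()

x₃≢-5 : ¬ x₃ ≡ - (+ 5)
x₃≢-5 ()

mainTheorem1 :
      (sum3cubes (+ 569936821221962380720) (- (+ 569936821113563493509)) (- (+ 472715493453327032)) ≡ + 3)
    × (sum3cubes (- (+ 80538738812075974)) (+ 80435758145817515) (+ 12602123297335631) ≡ + 42)
    × (sum3cubes (- (+ 385495523231271884)) (+ 383344975542639445) (+ 98422560467622814) ≡ + 165)
    × (sum3cubes (+ 143075750505019222645) (- (+ 143070303858622169975)) (- (+ 6941531883806363291)) ≡ + 579)
    × (sum3cubes (- (+ 74924259395610397)) (+ 72054089679353378) (+ 35961979615356503) ≡ + 906)
    × (∃[ x ] ∃[ y ] ∃[ z ] ((sum3cubes x y z ≡ + 3)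
        × ¬ (IsPermOf x y z (+ 1) (+ 1) (+ 1))
        × ¬ (IsPermOf x y z (+ 4) (+ 4) (- (+ 5)))))
mainTheorem1 =
  refl , refl , refl , refl , refl ,
  ( x₃ , - (+ 569936821113563493509) , - (+ 472715493453327032)
  , refl
  , notPermOf x₃≢1 x₃≢1 x₃≢1
  , notPermOf x₃≢4 x₃≢4 x₃≢-5 )
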